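{- Let $T$ be a decomposition tree and $v$ an internal node of $T$ labeled $\otimes$, with left child $v_l$ and right child $v_r$. Then $\hat\beta(v)=\hat\beta(v_l)+\hat\beta(v_r)$.
   Context: All graphs are finite, simple and undirected. For a graph $H$ and $S\subseteq V(H)$, $N_H[S]$ is the closed neighbourhood of $S$ in $H$ and $H[S]$ the induced subgraph; a graph with no vertices is regarded as having a (empty) perfect matching. A decomposition tree is a rooted tree $T$ in which every internal node has exactly two children, a left child $v_l$ and a right child $v_r$, and carries one of the labels $\otimes$ (true twin), $\odot$ (false twin), $\oplus$ (attachment). To each node $v$ are associated a graph $\hat G(v)$ and a twin set $\hat{TS}(v)\subseteq V(\hat G(v))$: for a leaf, $\hat G(v)$ is a single vertex $x$ (distinct leaves giving distinct vertices) and $\hat{TS}(v)=\{x\}$; for an internal node $v$, $V(\hat G(v))=V(\hat G(v_l))\cup V(\hat G(v_r))$ and: if $v$ is labeled $\otimes$, $E(\hat G(v))=E(\hat G(v_l))\cup E(\hat G(v_r))\cup\{xy: x\in \hat{TS}(v_l), y\in\hat{TS}(v_r)\}$ and $\hat{TS}(v)=\hat{TS}(v_l)\cup\hat{TS}(v_r)$; if labeled $\odot$, $E(\hat G(v))=E(\hat G(v_l))\cup E(\hat G(v_r))$ and $\hat{TS}(v)=\hat{TS}(v_l)\cup\hat{TS}(v_r)$; if labeled $\oplus$, the edge set is as for $\otimes$ and $\hat{TS}(v)=\hat{TS}(v_l)$. For a node $u$ and $0\le k\le|\hat{TS}(u)|$, $\hat\gamma_k(u)$ is the minimum of $|S|$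 over all $S\subseteq V(\hat G(u))$ with $V(\hat G(u))\setminus \hat{TS}(u)\subseteq N_{\hat G(u)}[S]$ for which there is $X\subseteq S\cap\hat{TS}(u)$, $|X|=k$, such that $\hat G(u)[S\setminus X]$ has a perfect matching. Let $\widehat{\min}(u)=\min\{\hat\gamma_k(u):0\le k\le|\hat{TS}(u)|\}$ and let $\hat\beta(u)$ be the largest $k$ with $\hat\gamma_k(u)=\widehat{\min}(u)$. -}

module Defs where

open import Data.Nat using (ℕ; zero; suc; _+_; _≤_)
open import Data.Bool using (Bool; true; false; _∧_)
open import Data.Fin using (Fin; splitAt)
open import Data.Fin.Subset using (Subset; _∈_; _∉_; _⊆_; _∩_; ∁; ∣_∣; ⁅_⁆; ⊥)
open import Data.Vec using (_++_; lookup)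
open import Data.Sum using (_⊎_; inj₁; inj₂)
open import Data.Product using (Σ; ∃; _×_; _,_)
open import Relation.Binary.PropositionalEquality using (_≡_; _≢_)

-- Labels: ⊗ true twin, ⊙ false twin, ⊕ attachment
data Label : Set where
  ⊗ ⊙ ⊕ : Label

data Tree : Set where
  leaf : Tree
  node : Label → Tree → Tree → Tree

-- Vertices of Ĝ(t) are
-- Fin (size t); for node lab l r, the vertices of Ĝ(l) are the first
-- size l elements, those of Ĝ(r) the remaining ones (via splitAt).
size : Tree → ℕ
size leaf = 1
size (node _ l r) = size l + size r

TS : (t : Tree) → Subset (size t)
TS leaf = ⁅ Fin.zero ⁆
TS (node ⊗ l r) = TS l ++ TS r
TS (node ⊙ l r) = TS l ++ TS r
TS (node ⊕ l r) = TS l ++ ⊥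

joins : Label → Bool
joins ⊗ = true
joins ⊙ = false
joins ⊕ = true

isIn : ∀ {n} → Subset n → Fin n → Bool
isIn S i = lookup S i

adj : (t : Tree) → Fin (size t) → Fin (size t) → Bool
adj leaf _ _ = false
adj (node lab l r) i j with splitAt (size l) i | splitAt (size l) j
... | inj₁ a | inj₁ b = adj l a b
... | inj₂ a | inj₂ b = adj r a b
... | inj₁ a | inj₂ b = joins lab ∧ isIn (TS l) a ∧ isIn (TS r) b
... | inj₂ a | inj₁ b = joins lab ∧ isIn (TS l) b ∧ isIn (TS r) a

Adj : (t : Tree) → Fin (size t) → Fin (size t) → Set
Adj t i j = adj t i j ≡ true

InClosedNbhd : (t : Tree) → Subset (size t) → Fin (size t) → Set
InClosedNbhd t S v = v ∈ S ⊎ Σ (Fin (size t)) (λ s → s ∈ S × Adj t s v)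

-- Ĝ(t)[S] has a perfect matching: a fixed-point-free involution m on S
-- with each x adjacent to its partner m x (the matching is {x, m x}).
HasPerfectMatching : (t : Tree) → Subset (size t) → Set
HasPerfectMatching t S =
  Σ (Fin (size t) → Fin (size t)) λ m →
    ∀ x → x ∈ S → (m x ∈ S) × (m x ≢ x) × (m (m x) ≡ x) × Adj t x (m x)

Feasible : (t : Tree) → ℕ → Subset (size t) → Set
Feasible t k S =
  (∀ v → v ∉ TS t → InClosedNbhd t S v) ×
  Σ (Subset (size t)) λ X →
    (X ⊆ (S ∩ TS t)) × (∣ X ∣ ≡ k) × HasPerfectMatching t (S ∩ ∁ X)

-- γ̂_k(t) = g  (for 0 ≤ k ≤ |TŜ(t)|; no value if no admissible S exists)
HasGamma : (t : Tree) → ℕ → ℕ → Set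
HasGamma t k g =
  (k ≤ ∣ TS t ∣) ×
  (Σ (Subset (size t)) λ S → Feasible t k S × (∣ S ∣ ≡ g)) ×
  (∀ S → Feasible t k S → g ≤ ∣ S ∣)

HasMin : Tree → ℕ → Set
HasMin t m = (∃ λ k → HasGamma t k m) × (∀ k g → HasGamma t k g → m ≤ g)

IsBeta : Tree → ℕ → Set
IsBeta t b = Σ ℕ λ m → HasMin t m × HasGamma t b m × (∀ k → HasGamma t k m → k ≤ b)

-- Ĝ(node ⊗ l r) is the disjoint union of Ĝ(l) and Ĝ(r) together with all edges between
-- their twin sets, and its twin set is the union of theirs.  Feasible sets of the two
-- children therefore glue to a feasible set of the parent, the sizes of S and of X adding
-- up.  Conversely a feasible set of the parent restricts to feasible sets of the children:
-- a vertex matched across the two sides lies in the twin set of its child, so it can be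
-- moved into X, which only increases |X|.  Hence min̂ is additive, a minimum-size feasible
-- set of the parent restricts to minimum-size feasible sets of the children, and so the
-- largest k attaining the minimum is additive too.
module Submission where

open import Defs
open import Data.Bool using (Bool; true; false; _∧_)
open import Data.Empty using (⊥-elim)
open import Data.Fin using (Fin; _↑ˡ_; _↑ʳ_; splitAt)
open import Data.Fin.Properties using (splitAt-↑ˡ; splitAt-↑ʳ; splitAt⁻¹-↑ˡ; splitAt⁻¹-↑ʳ; ↑ˡ-injective; ↑ʳ-injective)
open import Data.Fin.Subset using (Subset; _∈_; _∉_; _⊆_; _∩_; _∪_; ∁; ∣_∣)
open import Data.Fin.Subset.Properties using (x∈p∩q⁺; x∈p∩q⁻; x∈∁p⇒x∉p; x∉p⇒x∈∁p; x∈p∪q⁺; x∈p∪q⁻; p⊆q⇒∣p∣≤∣q∣; p⊆p∪q; _∈?_)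
open import Data.Maybe using (Maybe; just; nothing; fromMaybe; is-nothing)
open import Data.Nat using (ℕ; suc; _+_; _≤_; _<_; _≤?_)
open import Data.Nat.Induction using (<-rec)
open import Data.Nat.Properties using (≤-trans; ≮⇒≥; ≤-antisym; +-cancelʳ-≤; +-monoʳ-≤; +-mono-≤; +-comm; module ≤-Reasoning)
open import Data.Product using (Σ; ∃; _×_; _,_; proj₁; proj₂)
open import Data.Sum using (inj₁; inj₂; [_,_]′)
open import Data.Vec using ([]; _∷_; _++_; lookup; tabulate)
import Data.Vec as Vec
open import Data.Vec.Properties using ([]=⇒lookup; lookup⇒[]=; lookup∘tabulate; tabulate∘lookup; tabulate-cong; lookup-++ˡ; lookup-++ʳ; map-++; zipWith-++)
open import Function using (_∘_)
open import Relation.Binary.PropositionalEquality using (_≡_; _≢_; refl; sym; trans; cong; cong₂; subst)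
open import Relation.Nullary using (¬_; Dec; yes; no)
open import Relation.Nullary.Decidable using (decidable-stable; ¬¬-excluded-middle)

∧-true : ∀ {x y} → x ∧ y ≡ true → x ≡ true × y ≡ true
∧-true {true} y≡true = refl , y≡true

∈-resp-lookup : ∀ {m n} {p : Subset m} {q : Subset n} {x y} →
                lookup p x ≡ lookup q y → x ∈ p → y ∈ q
∈-resp-lookup {q = q} {y = y} e x∈p = lookup⇒[]= y q (trans (sym e) ([]=⇒lookup x∈p))

∈-tabulate⁺ : ∀ {n} {f : Fin n → Bool} {x} → f x ≡ true → x ∈ tabulate f
∈-tabulate⁺ {f = f} {x} fx = lookup⇒[]= x _ (trans (lookup∘tabulate f x) fx)

∈-tabulate⁻ : ∀ {n} {f : Fin n → Bool} {x} → x ∈ tabulate f → f x ≡ true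
∈-tabulate⁻ {f = f} {x} x∈ = trans (sym (lookup∘tabulate f x)) ([]=⇒lookup x∈)

preimage : ∀ {m n} → (Fin m → Fin n) → Subset n → Subset m
preimage f p = tabulate (lookup p ∘ f)

∈-preimage⁺ : ∀ {m n} {f : Fin m → Fin n} {p x} → f x ∈ p → x ∈ preimage f p
∈-preimage⁺ = ∈-tabulate⁺ ∘ []=⇒lookup

∈-preimage⁻ : ∀ {m n} {f : Fin m → Fin n} {p x} → x ∈ preimage f p → f x ∈ p
∈-preimage⁻ {p = p} = lookup⇒[]= _ p ∘ ∈-tabulate⁻

∣p++q∣≡∣p∣+∣q∣ : ∀ {m n} (p : Subset m) (q : Subset n) → ∣ p ++ q ∣ ≡ ∣ p ∣ + ∣ q ∣
∣p++q∣≡∣p∣+∣q∣ []          q = refl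
∣p++q∣≡∣p∣+∣q∣ (true ∷ p)  q = cong suc (∣p++q∣≡∣p∣+∣q∣ p q)
∣p++q∣≡∣p∣+∣q∣ (false ∷ p) q = ∣p++q∣≡∣p∣+∣q∣ p q

+-tightˡ : ∀ {m n x y} → m ≤ x → n ≤ y → x + y ≡ m + n → x ≡ m
+-tightˡ {m} {n} {x} {y} m≤x n≤y x+y≡m+n = ≤-antisym (+-cancelʳ-≤ y x m x+y≤m+y) m≤x
  where
  open ≤-Reasoning
  x+y≤m+y : x + y ≤ m + y
  x+y≤m+y = begin x + y ≡⟨ x+y≡m+n ⟩ m + n ≤⟨ +-monoʳ-≤ m n≤y ⟩ m + y ∎

+-tight : ∀ {m n x y} → m ≤ x → n ≤ y → x + y ≡ m + n → x ≡ m × y ≡ n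
+-tight {m} {n} {x} {y} m≤x n≤y x+y≡m+n =
  +-tightˡ m≤x n≤y x+y≡m+n ,
  +-tightˡ n≤y m≤x (trans (+-comm y x) (trans x+y≡m+n (+-comm m n)))

¬¬-least : (P : ℕ → Set) {n : ℕ} → P n → ¬ ¬ (∃ λ m → P m × ∀ {k} → P k → m ≤ k)
¬¬-least P {n} = <-rec (λ n → P n → ¬ ¬ Least) step n
  where
  Least = ∃ λ m → P m × ∀ {k} → P k → m ≤ k
  step : ∀ n → (∀ {k} → k < n → P k → ¬ ¬ Least) → P n → ¬ ¬ Least
  step n below Pn ¬least = ¬¬-excluded-middle {A = ∃ λ k → P k × k < n} λ
    { (yes (k , Pk , k<n)) → below k<n Pk ¬least
    ; (no ∄smaller) → ¬least (n , Pn , λ {k} Pk → ≮⇒≥ λ k<n → ∄smaller (k , Pk , k<n)) }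

Dominates : (t : Tree) → Subset (size t) → Set
Dominates t S = ∀ v → v ∉ TS t → InClosedNbhd t S v

MatchedIn : (t : Tree) → Subset (size t) → (Fin (size t) → Fin (size t)) → Fin (size t) → Set
MatchedIn t S m x = (m x ∈ S) × (m x ≢ x) × (m (m x) ≡ x) × Adj t x (m x)

module _ (t : Tree) {k : ℕ} {S : Subset (size t)} (F : Feasible t k S) where

  dominates : Dominates t S
  dominates = proj₁ F

  excess : Subset (size t)
  excess = proj₁ (proj₂ F)

  excess⊆ : excess ⊆ S ∩ TS t
  excess⊆ = proj₁ (proj₂ (proj₂ F))

  ∣excess∣ : ∣ excess ∣ ≡ k
  ∣excess∣ = proj₁ (proj₂ (proj₂ (proj₂ F)))

  matching : HasPerfectMatching t (S ∩ ∁ excess)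
  matching = proj₂ (proj₂ (proj₂ (proj₂ F)))

  feasible⇒k≤∣TS∣ : k ≤ ∣ TS t ∣
  feasible⇒k≤∣TS∣ = subst (_≤ ∣ TS t ∣) ∣excess∣ (p⊆q⇒∣p∣≤∣q∣ (proj₂ ∘ x∈p∩q⁻ S (TS t) ∘ excess⊆))

-- A least feasible size exists only up to double negation; this suffices because the
-- goal m ≤ ∣ S ∣ is decidable.
min≤∣feasible∣ : ∀ t {m k S} → HasMin t m → Feasible t k S → m ≤ ∣ S ∣
min≤∣feasible∣ t {m} {k} {S} (_ , min≤γ) F = decidable-stable (m ≤? ∣ S ∣) λ m≰∣S∣ →
  ¬¬-least (λ g → Σ (Subset (size t)) λ S′ → Feasible t k S′ × ∣ S′ ∣ ≡ g) (S , F , refl)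
    λ (g , witness , least) →
      m≰∣S∣ (≤-trans (min≤γ k g (feasible⇒k≤∣TS∣ t F , witness , λ S′ F′ → least (S′ , F′ , refl)))
                     (least (S , F , refl)))

HasGamma-intro : ∀ t {k g S} → Feasible t k S → ∣ S ∣ ≡ g →
                 (∀ S′ → Feasible t k S′ → g ≤ ∣ S′ ∣) → HasGamma t k g
HasGamma-intro t F ∣S∣≡g least = feasible⇒k≤∣TS∣ t F , (_ , F , ∣S∣≡g) , least

IsBeta-functional : ∀ t {b b′} → IsBeta t b → IsBeta t b′ → b ≡ b′
IsBeta-functional t (m , hasMin , γb , largest) (m′ , hasMin′ , γb′ , largest′)
  with ≤-antisym (proj₂ hasMin _ _ γb′) (proj₂ hasMin′ _ _ γb)
... | refl = ≤-antisym (largest′ _ γb) (largest _ γb′)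

adj-sym : ∀ t i j → adj t i j ≡ adj t j i
adj-sym leaf           i j = refl
adj-sym (node lab l r) i j with splitAt (size l) i | splitAt (size l) j
... | inj₁ a | inj₁ b = adj-sym l a b
... | inj₂ a | inj₂ b = adj-sym r a b
... | inj₁ a | inj₂ b = refl
... | inj₂ a | inj₁ b = refl

data Side : Set where
  left right : Side

_≟ˢ_ : (σ τ : Side) → Dec (σ ≡ τ)
left  ≟ˢ left  = yes refl
left  ≟ˢ right = no λ ()
right ≟ˢ left  = no λ ()
right ≟ˢ right = yes refl

module TrueTwin (l r : Tree) where

  t : Tree
  t = node ⊗ l r

  private
    n p : ℕ
    n = size l
    p = size r

  part : Side → Tree
  part left  = l
  part right = r

  inj : ∀ σ → Fin (size (part σ)) → Fin (size t)
  inj left  a = a ↑ˡ p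
  inj right a = n ↑ʳ a

  inj-injective : ∀ σ {a b} → inj σ a ≡ inj σ b → a ≡ b
  inj-injective left  = ↑ˡ-injective p _ _
  inj-injective right = ↑ʳ-injective n _ _

  data SideView : Fin (size t) → Set where
    at : ∀ σ a → SideView (inj σ a)

  sideView : ∀ j → SideView j
  sideView j with splitAt n j in eq
  ... | inj₁ a = subst SideView (splitAt⁻¹-↑ˡ eq) (at left a)
  ... | inj₂ b = subst SideView (splitAt⁻¹-↑ʳ eq) (at right b)

  copair : ∀ {A : Set} → (∀ σ → Fin (size (part σ)) → A) → Fin (size t) → A
  copair f j = [ f left , f right ]′ (splitAt n j)

  copair-inj : ∀ {A : Set} (f : ∀ σ → Fin (size (part σ)) → A) σ a → copair f (inj σ a) ≡ f σ a
  copair-inj f left  a rewrite splitAt-↑ˡ n a p = refl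
  copair-inj f right a rewrite splitAt-↑ʳ n p a = refl

  sameSide : ∀ σ τ → Fin (size (part τ)) → Maybe (Fin (size (part σ)))
  sameSide left  left  = just
  sameSide right right = just
  sameSide left  right = λ _ → nothing
  sameSide right left  = λ _ → nothing

  inj⁻¹ : ∀ σ → Fin (size t) → Maybe (Fin (size (part σ)))
  inj⁻¹ σ = copair (sameSide σ)

  inj⁻¹-inj : ∀ σ a → inj⁻¹ σ (inj σ a) ≡ just a
  inj⁻¹-inj left  = copair-inj (sameSide left) left
  inj⁻¹-inj right = copair-inj (sameSide right) right

  inj⁻¹-inj-≢ : ∀ {σ τ} → σ ≢ τ → ∀ b → inj⁻¹ σ (inj τ b) ≡ nothing
  inj⁻¹-inj-≢ {left}  {left}  σ≢τ = ⊥-elim (σ≢τ refl)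
  inj⁻¹-inj-≢ {left}  {right} _   = copair-inj (sameSide left) right
  inj⁻¹-inj-≢ {right} {left}  _   = copair-inj (sameSide right) left
  inj⁻¹-inj-≢ {right} {right} σ≢τ = ⊥-elim (σ≢τ refl)

  glue : (∀ σ → Subset (size (part σ))) → Subset (size t)
  glue A = A left ++ A right

  lookup-glue : ∀ A σ a → lookup (glue A) (inj σ a) ≡ lookup (A σ) a
  lookup-glue A left  = lookup-++ˡ (A left) (A right)
  lookup-glue A right = lookup-++ʳ (A left) (A right)

  ∈-glue⁺ : ∀ A σ {a} → a ∈ A σ → inj σ a ∈ glue A
  ∈-glue⁺ A σ {a} = ∈-resp-lookup (sym (lookup-glue A σ a))

  ∈-glue⁻ : ∀ A σ a → inj σ a ∈ glue A → a ∈ A σ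
  ∈-glue⁻ A σ a = ∈-resp-lookup (lookup-glue A σ a)

  ∣glue∣ : ∀ A → ∣ glue A ∣ ≡ ∣ A left ∣ + ∣ A right ∣
  ∣glue∣ A = ∣p++q∣≡∣p∣+∣q∣ (A left) (A right)

  glue-∩-∁ : ∀ A B → glue A ∩ ∁ (glue B) ≡ glue (λ σ → A σ ∩ ∁ (B σ))
  glue-∩-∁ A B = trans (cong (glue A ∩_) (map-++ _ (B left) (B right)))
                       (zipWith-++ _∧_ (A left) (A right) (∁ (B left)) (∁ (B right)))

  restrict : ∀ σ → Subset (size t) → Subset (size (part σ))
  restrict σ = preimage (inj σ)

  restrict-glue : ∀ A σ → restrict σ (glue A) ≡ A σ
  restrict-glue A σ = trans (tabulate-cong (lookup-glue A σ)) (tabulate∘lookup (A σ))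

  ∣p∣≡∣restrict∣+∣restrict∣ : ∀ S → ∣ S ∣ ≡ ∣ restrict left S ∣ + ∣ restrict right S ∣
  ∣p∣≡∣restrict∣+∣restrict∣ S with Vec.splitAt n S
  ... | Sₗ , Sᵣ , refl = trans (∣glue∣ A) (sym (cong₂ _+_ (cong ∣_∣ (restrict-glue A left))
                                                        (cong ∣_∣ (restrict-glue A right))))
    where
    A : ∀ σ → Subset (size (part σ))
    A left  = Sₗ
    A right = Sᵣ

  adj-inj : ∀ σ a b → adj t (inj σ a) (inj σ b) ≡ adj (part σ) a b
  adj-inj left  a b rewrite splitAt-↑ˡ n a p | splitAt-↑ˡ n b p = refl
  adj-inj right a b rewrite splitAt-↑ʳ n p a | splitAt-↑ʳ n p b = refl

  crossing-edge : ∀ {σ τ} → σ ≢ τ → ∀ a b → Adj t (inj σ a) (inj τ b) → a ∈ TS (part σ)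
  crossing-edge {left}  {left}  σ≢τ _ _ _ = ⊥-elim (σ≢τ refl)
  crossing-edge {left}  {right} _   a b a~b
    rewrite splitAt-↑ˡ n a p | splitAt-↑ʳ n p b = lookup⇒[]= a (TS l) (∧-true a~b .proj₁)
  crossing-edge {right} {left}  _   a b a~b
    rewrite splitAt-↑ʳ n p a | splitAt-↑ˡ n b p = lookup⇒[]= a (TS r) (∧-true a~b .proj₂)
  crossing-edge {right} {right} σ≢τ _ _ _ = ⊥-elim (σ≢τ refl)

  ∈TS⁺ : ∀ σ {a} → a ∈ TS (part σ) → inj σ a ∈ TS t
  ∈TS⁺ = ∈-glue⁺ (λ σ → TS (part σ))

  ∈TS⁻ : ∀ σ a → inj σ a ∈ TS t → a ∈ TS (part σ)
  ∈TS⁻ = ∈-glue⁻ (λ σ → TS (part σ))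

  glue-dominates : ∀ {S} → (∀ σ → Dominates (part σ) (S σ)) → Dominates t (glue S)
  glue-dominates {S} D v v∉TS with sideView v
  ... | at σ a with D σ a (v∉TS ∘ ∈TS⁺ σ)
  ...   | inj₁ a∈S = inj₁ (∈-glue⁺ S σ a∈S)
  ...   | inj₂ (s , s∈S , s~a) = inj₂ (inj σ s , ∈-glue⁺ S σ s∈S , trans (adj-inj σ s a) s~a)

  glue-matching : ∀ {A} → (∀ σ → HasPerfectMatching (part σ) (A σ)) → HasPerfectMatching t (glue A)
  glue-matching {A} M = m , matched
    where
    f : ∀ σ → Fin (size (part σ)) → Fin (size t)
    f σ a = inj σ (proj₁ (M σ) a)
    m : Fin (size t) → Fin (size t)
    m = copair f
    matched : ∀ x → x ∈ glue A → MatchedIn t (glue A) m x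
    matched x x∈A with sideView x
    ... | at σ a with proj₂ (M σ) a (∈-glue⁻ A σ a x∈A)
    ...   | Ma∈A , Ma≢a , MMa≡a , a~Ma rewrite copair-inj f σ a =
      ∈-glue⁺ A σ Ma∈A , Ma≢a ∘ inj-injective σ , trans (copair-inj f σ _) (cong (inj σ) MMa≡a) ,
      trans (adj-inj σ a _) a~Ma

  glue-feasible : ∀ {k : Side → ℕ} {S : ∀ σ → Subset (size (part σ))} →
                  (∀ σ → Feasible (part σ) (k σ) (S σ)) → Feasible t (k left + k right) (glue S)
  glue-feasible {k} {S} F =
      glue-dominates (λ σ → dominates (part σ) (F σ))
    , glue X , X⊆ , trans (∣glue∣ X) (cong₂ _+_ (∣excess∣ l (F left)) (∣excess∣ r (F right)))
    , subst (HasPerfectMatching t) (sym (glue-∩-∁ S X)) (glue-matching λ σ → matching (part σ) (F σ))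
    where
    X : ∀ σ → Subset (size (part σ))
    X σ = excess (part σ) (F σ)
    X⊆ : glue X ⊆ glue S ∩ TS t
    X⊆ {v} v∈X with sideView v
    ... | at σ a with x∈p∩q⁻ _ _ (excess⊆ (part σ) (F σ) (∈-glue⁻ X σ a v∈X))
    ...   | a∈S , a∈TS = x∈p∩q⁺ (∈-glue⁺ S σ a∈S , ∈TS⁺ σ a∈TS)

  outside : ∀ σ → Fin (size t) → Bool
  outside σ j = is-nothing (inj⁻¹ σ j)

  outside-inj : ∀ σ a → outside σ (inj σ a) ≡ false
  outside-inj σ a = cong is-nothing (inj⁻¹-inj σ a)

  outside-inj-≢ : ∀ {σ τ} → σ ≢ τ → ∀ b → outside σ (inj τ b) ≡ true
  outside-inj-≢ σ≢τ b = cong is-nothing (inj⁻¹-inj-≢ σ≢τ b)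

  leaving-edge : ∀ σ a j → outside σ j ≡ true → Adj t (inj σ a) j → a ∈ TS (part σ)
  leaving-edge σ a j j-outside a~j with sideView j
  ... | at τ b with σ ≟ˢ τ
  ...   | no σ≢τ = crossing-edge σ≢τ a b a~j
  ...   | yes refl with trans (sym (outside-inj σ b)) j-outside
  ...     | ()

  module Restriction {k : ℕ} {S : Subset (size t)} (F : Feasible t k S) where

    private
      X : Subset (size t)
      X = excess t F
      m : Fin (size t) → Fin (size t)
      m = proj₁ (matching t F)
      matched : ∀ x → x ∈ S ∩ ∁ X → MatchedIn t (S ∩ ∁ X) m x
      matched = proj₂ (matching t F)

    crossing : ∀ σ → Subset (size (part σ))
    crossing σ = tabulate (outside σ ∘ m ∘ inj σ)

    -- A vertex of S ∖ X matched across to the other side lies in the twin set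
    -- (leaving-edge), so it is moved into the excess.
    excess′ : ∀ σ → Subset (size (part σ))
    excess′ σ = restrict σ X ∪ (restrict σ S ∩ crossing σ)

    restrict⊆excess′ : ∀ σ → restrict σ X ⊆ excess′ σ
    restrict⊆excess′ σ = p⊆p∪q _

    kept : ∀ σ → Subset (size (part σ))
    kept σ = restrict σ S ∩ ∁ (excess′ σ)

    restrict-dominates : ∀ σ → Dominates (part σ) (restrict σ S)
    restrict-dominates σ a a∉TS with dominates t F (inj σ a) (a∉TS ∘ ∈TS⁻ σ a)
    ... | inj₁ x∈S = inj₁ (∈-preimage⁺ x∈S)
    ... | inj₂ (s , s∈S , s~x) with sideView s
    ...   | at τ b with σ ≟ˢ τ
    ...     | yes refl = inj₂ (b , ∈-preimage⁺ s∈S , trans (sym (adj-inj σ b a)) s~x)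
    ...     | no σ≢τ = ⊥-elim (a∉TS (crossing-edge σ≢τ a b (trans (adj-sym t _ _) s~x)))

    excess-restricts : ∀ σ a → inj σ a ∈ X → a ∈ restrict σ S ∩ TS (part σ)
    excess-restricts σ a x∈X with x∈p∩q⁻ S (TS t) (excess⊆ t F x∈X)
    ... | x∈S , x∈TS = x∈p∩q⁺ (∈-preimage⁺ x∈S , ∈TS⁻ σ a x∈TS)

    excess′⊆ : ∀ σ → excess′ σ ⊆ restrict σ S ∩ TS (part σ)
    excess′⊆ σ {a} a∈X′ with x∈p∪q⁻ (restrict σ X) _ a∈X′
    ... | inj₁ a∈X = excess-restricts σ a (∈-preimage⁻ a∈X)
    ... | inj₂ a∈S∩C with x∈p∩q⁻ _ _ a∈S∩C | inj σ a ∈? X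
    ...   | _ , _     | yes x∈X = excess-restricts σ a x∈X
    ...   | a∈S , a∈C | no x∉X  =
      x∈p∩q⁺ (a∈S , leaving-edge σ a (m (inj σ a)) (∈-tabulate⁻ a∈C) x~mx)
      where
      x∈S∖X : inj σ a ∈ S ∩ ∁ X
      x∈S∖X = x∈p∩q⁺ (∈-preimage⁻ a∈S , x∉p⇒x∈∁p x∉X)
      x~mx : Adj t (inj σ a) (m (inj σ a))
      x~mx = proj₂ (proj₂ (proj₂ (matched (inj σ a) x∈S∖X)))

    crossing⇒excess′ : ∀ σ {a} → a ∈ restrict σ S → a ∈ crossing σ → a ∈ excess′ σ
    crossing⇒excess′ σ a∈S a∈C = x∈p∪q⁺ (inj₂ (x∈p∩q⁺ (a∈S , a∈C)))

    kept⇒ : ∀ σ {a} → a ∈ kept σ → inj σ a ∈ S ∩ ∁ X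
    kept⇒ σ a∈kept with x∈p∩q⁻ _ _ a∈kept
    ... | a∈S , a∉X′ =
      x∈p∩q⁺ (∈-preimage⁻ a∈S , x∉p⇒x∈∁p (x∈∁p⇒x∉p a∉X′ ∘ restrict⊆excess′ σ ∘ ∈-preimage⁺))

    ⇒kept : ∀ σ {a} → inj σ a ∈ S ∩ ∁ X → a ∉ crossing σ → a ∈ kept σ
    ⇒kept σ x∈S∖X a∉C with x∈p∩q⁻ _ _ x∈S∖X
    ... | x∈S , x∉X = x∈p∩q⁺ (∈-preimage⁺ x∈S , x∉p⇒x∈∁p λ a∈X′ →
      [ x∈∁p⇒x∉p x∉X ∘ ∈-preimage⁻ , a∉C ∘ proj₂ ∘ x∈p∩q⁻ _ _ ]′ (x∈p∪q⁻ _ _ a∈X′))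

    -- The default a is only taken outside kept σ.
    m′ : ∀ σ → Fin (size (part σ)) → Fin (size (part σ))
    m′ σ a = fromMaybe a (inj⁻¹ σ (m (inj σ a)))

    m′-inside : ∀ σ a b → m (inj σ a) ≡ inj σ b → m′ σ a ≡ b
    m′-inside σ a b e = cong (fromMaybe a) (trans (cong (inj⁻¹ σ) e) (inj⁻¹-inj σ b))

    restrict-matching : ∀ σ → HasPerfectMatching (part σ) (kept σ)
    restrict-matching σ = m′ σ , λ a a∈kept → matched-via a a∈kept (sideView (m (inj σ a))) refl
      where
      matched-via : ∀ a → a ∈ kept σ → ∀ {j} → SideView j → m (inj σ a) ≡ j →
                    MatchedIn (part σ) (kept σ) (m′ σ) a
      matched-via a a∈kept (at τ b) e with σ ≟ˢ τ
      ... | no σ≢τ = ⊥-elim (x∈∁p⇒x∉p a∉X′ (crossing⇒excess′ σ a∈S (∈-tabulate⁺ mx-outside)))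
        where
        a∈S : a ∈ restrict σ S
        a∈S = proj₁ (x∈p∩q⁻ _ _ a∈kept)
        a∉X′ : a ∈ ∁ (excess′ σ)
        a∉X′ = proj₂ (x∈p∩q⁻ _ _ a∈kept)
        mx-outside : outside σ (m (inj σ a)) ≡ true
        mx-outside = trans (cong (outside σ) e) (outside-inj-≢ σ≢τ b)
      ... | yes refl with matched (inj σ a) (kept⇒ σ a∈kept)
      ...   | mx∈ , mx≢x , mmx≡x , x~mx =
        subst (λ c → (c ∈ kept σ) × (c ≢ a) × (m′ σ c ≡ a) × Adj (part σ) a c)
              (sym (m′-inside σ a b e))
          (⇒kept σ (subst (_∈ S ∩ ∁ X) e mx∈) b∉C , b≢a , m′-inside σ b a mb≡a ,
           trans (sym (adj-inj σ a b)) (subst (Adj t (inj σ a)) e x~mx))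
        where
        mb≡a : m (inj σ b) ≡ inj σ a
        mb≡a = trans (cong m (sym e)) mmx≡x
        b≢a : b ≢ a
        b≢a b≡a = mx≢x (trans e (cong (inj σ) b≡a))
        b∉C : b ∉ crossing σ
        b∉C b∈C with trans (sym (trans (cong (outside σ) mb≡a) (outside-inj σ a))) (∈-tabulate⁻ b∈C)
        ... | ()

    restrict-feasible : ∀ σ → Feasible (part σ) ∣ excess′ σ ∣ (restrict σ S)
    restrict-feasible σ = restrict-dominates σ , excess′ σ , excess′⊆ σ , refl , restrict-matching σ

    k≤∑∣excess′∣ : k ≤ ∣ excess′ left ∣ + ∣ excess′ right ∣
    k≤∑∣excess′∣ = begin
      k                                           ≡⟨ ∣excess∣ t F ⟨
      ∣ X ∣                                       ≡⟨ ∣p∣≡∣restrict∣+∣restrict∣ X ⟩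
      ∣ restrict left X ∣ + ∣ restrict right X ∣  ≤⟨ +-mono-≤ (∣restrict∣≤ left) (∣restrict∣≤ right) ⟩
      ∣ excess′ left ∣ + ∣ excess′ right ∣        ∎
      where
      open ≤-Reasoning
      ∣restrict∣≤ : ∀ σ → ∣ restrict σ X ∣ ≤ ∣ excess′ σ ∣
      ∣restrict∣≤ σ = p⊆q⇒∣p∣≤∣q∣ (restrict⊆excess′ σ)

  module Beta (b : Side → ℕ) (B : ∀ σ → IsBeta (part σ) (b σ)) where

    min : Side → ℕ
    min σ = proj₁ (B σ)

    hasMin : ∀ σ → HasMin (part σ) (min σ)
    hasMin σ = proj₁ (proj₂ (B σ))

    optimal : ∀ σ → HasGamma (part σ) (b σ) (min σ)
    optimal σ = proj₁ (proj₂ (proj₂ (B σ)))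

    largest : ∀ σ k → HasGamma (part σ) k (min σ) → k ≤ b σ
    largest σ = proj₂ (proj₂ (proj₂ (B σ)))

    optimum : ∀ σ → Subset (size (part σ))
    optimum σ = proj₁ (proj₁ (proj₂ (optimal σ)))

    optimum-feasible : ∀ σ → Feasible (part σ) (b σ) (optimum σ)
    optimum-feasible σ = proj₁ (proj₂ (proj₁ (proj₂ (optimal σ))))

    ∣optimum∣ : ∀ σ → ∣ optimum σ ∣ ≡ min σ
    ∣optimum∣ σ = proj₂ (proj₂ (proj₁ (proj₂ (optimal σ))))

    min≤∣restrict∣ : ∀ {k S} → Feasible t k S → ∀ σ → min σ ≤ ∣ restrict σ S ∣
    min≤∣restrict∣ F σ = min≤∣feasible∣ (part σ) (hasMin σ) (Restriction.restrict-feasible F σ)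

    min+min≤∣feasible∣ : ∀ {k S} → Feasible t k S → min left + min right ≤ ∣ S ∣
    min+min≤∣feasible∣ {S = S} F = begin
      min left + min right                        ≤⟨ +-mono-≤ (min≤∣restrict∣ F left) (min≤∣restrict∣ F right) ⟩
      ∣ restrict left S ∣ + ∣ restrict right S ∣  ≡⟨ ∣p∣≡∣restrict∣+∣restrict∣ S ⟨
      ∣ S ∣                                       ∎
      where open ≤-Reasoning

    optimal-t : HasGamma t (b left + b right) (min left + min right)
    optimal-t = HasGamma-intro t (glue-feasible optimum-feasible)
                  (trans (∣glue∣ optimum) (cong₂ _+_ (∣optimum∣ left) (∣optimum∣ right)))
                  (λ _ → min+min≤∣feasible∣)

    hasMin-t : HasMin t (min left + min right)
    hasMin-t = (_ , optimal-t) , λ { _ _ (_ , (_ , F , ∣S∣≡g) , _) →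
      subst (min left + min right ≤_) ∣S∣≡g (min+min≤∣feasible∣ F) }

    largest-t : ∀ k → HasGamma t k (min left + min right) → k ≤ b left + b right
    largest-t k (_ , (S , F , ∣S∣≡min) , _) = begin
      k                                     ≤⟨ k≤∑∣excess′∣ ⟩
      ∣ excess′ left ∣ + ∣ excess′ right ∣  ≤⟨ +-mono-≤ (largest left _ (γ left)) (largest right _ (γ right)) ⟩
      b left + b right                      ∎
      where
      open ≤-Reasoning
      open Restriction F
      tight : ∣ restrict left S ∣ ≡ min left × ∣ restrict right S ∣ ≡ min right
      tight = +-tight (min≤∣restrict∣ F left) (min≤∣restrict∣ F right)
                      (trans (sym (∣p∣≡∣restrict∣+∣restrict∣ S)) ∣S∣≡min)
      ∣restrict∣≡min : ∀ σ → ∣ restrict σ S ∣ ≡ min σ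
      ∣restrict∣≡min left  = proj₁ tight
      ∣restrict∣≡min right = proj₂ tight
      γ : ∀ σ → HasGamma (part σ) ∣ excess′ σ ∣ (min σ)
      γ σ = HasGamma-intro (part σ) (restrict-feasible σ) (∣restrict∣≡min σ)
              (λ _ → min≤∣feasible∣ (part σ) (hasMin σ))

    isBeta : IsBeta t (b left + b right)
    isBeta = _ , hasMin-t , optimal-t , largest-t

lemma9 : (l r : Tree) (bl br : ℕ) → IsBeta l bl → IsBeta r br →
         IsBeta (node ⊗ l r) (bl + br) × (∀ b → IsBeta (node ⊗ l r) b → b ≡ bl + br)
lemma9 l r bl br βl βr = isBeta , λ _ β′ → IsBeta-functional t β′ isBeta
  where
  open TrueTwin l r
  b : Side → ℕ
  b left  = bl
  b right = br
  β : ∀ σ → IsBeta (part σ) (b σ)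
  β left  = βl
  β right = βr
  open Beta b β
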